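{- Let $n$ be an odd positive integer and let $A,B,C,D\in\{\pm1\}^{n\times n}$ be (circulant) good matrices of order $n$, with defining rows $(a_0,\dotsc,a_{n-1})$, $(b_0,\dotsc,b_{n-1})$, $(c_0,\dotsc,c_{n-1})$, $(d_0,\dotsc,d_{n-1})$. Then \[ a_k\, b_k\, c_k\, d_k = -\,a_{2k \bmod n}\, b_0\, c_0\, d_0 \] for all integers $1\leq k<n$.
   Context: A square matrix $X=(x_{i,j})_{0\le i,j<n}$ is symmetric if $x_{i,j}=x_{j,i}$ for all $i,j$; it is skew if all diagonal entries equal $1$ and $x_{i,j}=-x_{j,i}$ for $i\neq j$; it is circulant if $x_{i,j}=x_{i-1,j-1}$ for all $i,j$ (indices mod $n$). In this statement, four matrices $A,B,C,D\in\{\pm1\}^{n\times n}$ are called good matrices of order $n$ if: (a') $A,B,C,D$ are circulant; (b) $A$ is skew and $B,C,D$ are symmetric; (c) $AA^T+B^2+C^2+D^2=4nI_n$. The defining row of a circulant matrix is its first row $(x_0,\dotsc,x_{n-1})$ (entries $x_{0,j}$). -}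

module Defs where

open import Data.Nat as ℕ using (ℕ; zero; suc; NonZero)
open import Data.Nat.DivMod using (_%_; _mod_)
open import Data.Fin using (Fin; toℕ) renaming (zero to fzero; suc to fsuc)
open import Relation.Nullary using (yes; no)
open import Data.Integer as ℤ using (ℤ; +_; -_; _+_; _*_; 1ℤ; 0ℤ)
open import Data.Product using (_×_)
open import Data.Sum using (_⊎_)
open import Relation.Binary.PropositionalEquality using (_≡_; _≢_)

Matrix : ℕ → Set
Matrix n = Fin n → Fin n → ℤ

Σ[<_] : (n : ℕ) → (Fin n → ℤ) → ℤ
Σ[< zero  ] f = 0ℤ
Σ[< suc n ] f = f fzero + Σ[< n ] (λ i → f (fsuc i))

transpose : ∀ {n} → Matrix n → Matrix n
transpose X i j = X j i

_·_ : ∀ {n} → Matrix n → Matrix n → Matrix n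
_·_ {n} X Y i j = Σ[< n ] (λ k → X i k * Y k j)

_⊕_ : ∀ {n} → Matrix n → Matrix n → Matrix n
(X ⊕ Y) i j = X i j + Y i j

scalarId : ∀ {n} → ℤ → Matrix n
scalarId c i j with toℕ i ℕ.≟ toℕ j
... | yes _ = c
... | no _ = 0ℤ

PlusMinusOne : ∀ {n} → Matrix n → Set
PlusMinusOne X = ∀ i j → (X i j ≡ 1ℤ) ⊎ (X i j ≡ - 1ℤ)

Symmetric : ∀ {n} → Matrix n → Set
Symmetric X = ∀ i j → X i j ≡ X j i

Skew : ∀ {n} → Matrix n → Set
Skew X = (∀ i → X i i ≡ 1ℤ) × (∀ i j → i ≢ j → X i j ≡ - X j i)

predMod : ∀ {n} → Fin (suc n) → Fin (suc n)
predMod {n} i = (toℕ i ℕ.+ n) mod (suc n)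

Circulant : ∀ {n} → Matrix (suc n) → Set
Circulant X = ∀ i j → X i j ≡ X (predMod i) (predMod j)

Good : (m : ℕ) → (A B C D : Matrix (suc m)) → Set
Good m A B C D =
  (PlusMinusOne A × PlusMinusOne B × PlusMinusOne C × PlusMinusOne D) ×
  (Circulant A × Circulant B × Circulant C × Circulant D) ×
  (Skew A × Symmetric B × Symmetric C × Symmetric D) ×
  ((((A · transpose A) ⊕ (B · B)) ⊕ (C · C)) ⊕ (D · D)) ≡ scalarId (+ (4 ℕ.* suc m))

-- Let n = 2t + 1 and view the defining rows a, b, c, d as n-periodic sequences. Since n is odd,
-- 2k ≢ 0 (mod n), so entry (0, 2k) of A Aᵀ + B² + C² + D² = 4n I vanishes; for circulants it is a
-- correlation of a plus the convolutions Σ_l x_{2k-l} x_l of b, c, d. Recentred at k, the terms l and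
-- -l of such a convolution coincide, so it equals x_k² + 2 Σ_{s=1}^{t} x_{k+s} x_{k-s}; as
-- x_u x_v ≡ x_u + x_v - 1 (mod 4) for signs, this is 1 + 2 (Σ x - x_k) - 2t modulo 8. Skewness turns
-- the correlation of a into 2 a_{2k} minus its convolution and gives Σ a = 1, while symmetry gives
-- Σ x ≡ x_0 + 2t (mod 4). Adding up, a_{2k} + a_k + b_0 + c_0 + d_0 - b_k - c_k - d_k ≡ 0 (mod 4), and
-- eight signs whose sum is divisible by 4 have product 1.
module Submission where

module GoodMatrices where
  open import Data.Nat as ℕ using (ℕ; zero; suc; z≤n; s≤s; _%_)
  import Data.Nat.Properties as ℕₚ
  open import Data.Nat.DivMod
    using (_mod_; [m+kn]%n≡m%n; [m+n]%n≡m%n; %-distribˡ-+; %-distribˡ-*; m%n%n≡m%n; m<n⇒m%n≡m)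
  import Data.Nat.Divisibility as ℕ∣
  import Data.Nat.Tactic.RingSolver as ℕSolver
  open import Data.Integer as ℤ using (ℤ; +_; -_; _+_; _-_; _*_; 0ℤ; 1ℤ)
  import Data.Integer.Properties as ℤₚ
  open import Data.Integer.Divisibility.Signed
    using (_∣_; divides; ∣m∣n⇒∣m+n; ∣m⇒∣-m; *-monoʳ-∣; *-cancelˡ-∣)
  open import Data.Integer.Tactic.RingSolver using (solve-∀)
  open import Data.Fin using (Fin; toℕ; fromℕ<) renaming (zero to fzero; suc to fsuc)
  import Data.Fin.Properties as Finₚ
  open import Data.List using ([]; _∷_; length; foldr)
  open import Data.List.Relation.Unary.All using (All; []; _∷_)
  open import Data.Product using (_×_; _,_)
  open import Data.Sum using (_⊎_; inj₁; inj₂)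
  open import Function using (_∘_)
  open import Relation.Nullary using (¬_; yes; no; contradiction)
  open import Relation.Binary.Bundles using (Setoid)
  open import Relation.Binary.Structures using (IsEquivalence)
  open import Relation.Binary.PropositionalEquality
  import Relation.Binary.Reasoning.Setoid as SetoidReasoning
  open import Defs

  ∑ : ℕ → (ℕ → ℤ) → ℤ
  ∑ zero    f = 0ℤ
  ∑ (suc k) f = f 0 + ∑ k (f ∘ suc)

  ∑-cong : ∀ k {f g : ℕ → ℤ} → (∀ r → r ℕ.< k → f r ≡ g r) → ∑ k f ≡ ∑ k g
  ∑-cong zero    f≡g = refl
  ∑-cong (suc k) f≡g = cong₂ _+_ (f≡g 0 (s≤s z≤n)) (∑-cong k (λ r r<k → f≡g (suc r) (s≤s r<k)))

  ∑-ext : ∀ k {f g : ℕ → ℤ} → (∀ r → f r ≡ g r) → ∑ k f ≡ ∑ k g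
  ∑-ext k f≡g = ∑-cong k (λ r _ → f≡g r)

  ∑-snoc : ∀ k f → ∑ (suc k) f ≡ ∑ k f + f k
  ∑-snoc zero    f = ℤₚ.+-comm (f 0) 0ℤ
  ∑-snoc (suc k) f = trans (cong (_+_ (f 0)) (∑-snoc k (f ∘ suc))) (sym (ℤₚ.+-assoc (f 0) _ _))

  ∑-split : ∀ a b f → ∑ (a ℕ.+ b) f ≡ ∑ a f + ∑ b (λ r → f (a ℕ.+ r))
  ∑-split zero    b f = sym (ℤₚ.+-identityˡ _)
  ∑-split (suc a) b f = trans (cong (_+_ (f 0)) (∑-split a b (f ∘ suc))) (sym (ℤₚ.+-assoc (f 0) _ _))

  ∑-reverse : ∀ k f → ∑ k f ≡ ∑ k (λ r → f (k ℕ.∸ suc r))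
  ∑-reverse zero    f = refl
  ∑-reverse (suc k) f = begin
    f 0 + ∑ k (f ∘ suc)                      ≡⟨ cong (_+_ (f 0)) (∑-reverse k (f ∘ suc)) ⟩
    f 0 + ∑ k (λ r → f (suc (k ℕ.∸ suc r)))  ≡⟨ cong (_+_ (f 0)) (∑-cong k λ r r<k →
                                                  cong f (sym (ℕₚ.+-∸-assoc 1 r<k))) ⟩
    f 0 + ∑ k (λ r → f (k ℕ.∸ r))            ≡⟨ ℤₚ.+-comm (f 0) _ ⟩
    ∑ k (λ r → f (k ℕ.∸ r)) + f 0            ≡⟨ cong (λ i → ∑ k (λ r → f (k ℕ.∸ r)) + f i)
                                                     (ℕₚ.n∸n≡0 k) ⟨
    ∑ k (λ r → f (k ℕ.∸ r)) + f (k ℕ.∸ k)    ≡⟨ ∑-snoc k (λ r → f (suc k ℕ.∸ suc r)) ⟨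
    ∑ (suc k) (λ r → f (suc k ℕ.∸ suc r))    ∎
    where open ≡-Reasoning

  ∑-+ : ∀ k f g → ∑ k (λ r → f r + g r) ≡ ∑ k f + ∑ k g
  ∑-+ zero    f g = refl
  ∑-+ (suc k) f g =
    trans (cong (_+_ (f 0 + g 0)) (∑-+ k (f ∘ suc) (g ∘ suc))) (interchange (f 0) (g 0) _ _)
    where
    interchange : ∀ a b c d → (a + b) + (c + d) ≡ (a + c) + (b + d)
    interchange = solve-∀

  ∑-const : ∀ k c → ∑ k (λ _ → c) ≡ + k * c
  ∑-const zero    c = sym (ℤₚ.*-zeroˡ c)
  ∑-const (suc k) c = trans (cong (_+_ c) (∑-const k c)) (sym (ℤₚ.suc-* (+ k) c))

  ∑-neg : ∀ k f → ∑ k (λ r → - f r) ≡ - ∑ k f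
  ∑-neg zero    f = refl
  ∑-neg (suc k) f = trans (cong (_+_ (- f 0)) (∑-neg k (f ∘ suc))) (sym (ℤₚ.neg-distrib-+ (f 0) _))

  ∑-*ˡ : ∀ k c f → ∑ k (λ r → c * f r) ≡ c * ∑ k f
  ∑-*ˡ zero    c f = sym (ℤₚ.*-zeroʳ c)
  ∑-*ˡ (suc k) c f =
    trans (cong (_+_ (c * f 0)) (∑-*ˡ k c (f ∘ suc))) (sym (ℤₚ.*-distribˡ-+ c (f 0) _))

  Σ[<]≡∑ : ∀ k {g : Fin k → ℤ} (f : ℕ → ℤ) → (∀ i → g i ≡ f (toℕ i)) → Σ[< k ] g ≡ ∑ k f
  Σ[<]≡∑ zero    f g≡f = refl
  Σ[<]≡∑ (suc k) f g≡f = cong₂ _+_ (g≡f fzero) (Σ[<]≡∑ k (f ∘ suc) (g≡f ∘ fsuc))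

  -- A record rather than a synonym for d ∣ a - b, so that a, b and d can be inferred.
  infix 4 _≡_[mod_]
  record _≡_[mod_] (a b d : ℤ) : Set where
    constructor [mod]⟨_⟩
    field divides-difference : d ∣ a - b

  ≡⇒≡[mod] : ∀ {a b} d → a ≡ b → a ≡ b [mod d ]
  ≡⇒≡[mod] {a} d refl = [mod]⟨ divides 0ℤ (trans (ℤₚ.+-inverseʳ a) (sym (ℤₚ.*-zeroˡ d))) ⟩

  [mod]-sym : ∀ {a b d} → a ≡ b [mod d ] → b ≡ a [mod d ]
  [mod]-sym {a} {b} [mod]⟨ d∣a-b ⟩ = [mod]⟨ subst (_ ∣_) (negate a b) (∣m⇒∣-m d∣a-b) ⟩
    where
    negate : ∀ a b → - (a - b) ≡ b - a
    negate = solve-∀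

  [mod]-trans : ∀ {a b c d} → a ≡ b [mod d ] → b ≡ c [mod d ] → a ≡ c [mod d ]
  [mod]-trans {a} {b} {c} [mod]⟨ d∣a-b ⟩ [mod]⟨ d∣b-c ⟩ =
    [mod]⟨ subst (_ ∣_) (telescope a b c) (∣m∣n⇒∣m+n d∣a-b d∣b-c) ⟩
    where
    telescope : ∀ a b c → (a - b) + (b - c) ≡ a - c
    telescope = solve-∀

  [mod]-setoid : ℤ → Setoid _ _
  [mod]-setoid d = record { isEquivalence = [mod]-isEquivalence }
    where
    [mod]-isEquivalence : IsEquivalence (_≡_[mod d ])
    [mod]-isEquivalence = record { refl = ≡⇒≡[mod] d refl ; sym = [mod]-sym ; trans = [mod]-trans }

  +-cong-[mod] : ∀ {a b c e d} → a ≡ b [mod d ] → c ≡ e [mod d ] → a + c ≡ b + e [mod d ]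
  +-cong-[mod] {a} {b} {c} {e} [mod]⟨ d∣a-b ⟩ [mod]⟨ d∣c-e ⟩ =
    [mod]⟨ subst (_ ∣_) (regroup a b c e) (∣m∣n⇒∣m+n d∣a-b d∣c-e) ⟩
    where
    regroup : ∀ a b c e → (a - b) + (c - e) ≡ (a + c) - (b + e)
    regroup = solve-∀

  +-congˡ-[mod] : ∀ a {b c d} → b ≡ c [mod d ] → a + b ≡ a + c [mod d ]
  +-congˡ-[mod] a = +-cong-[mod] (≡⇒≡[mod] _ (refl {x = a}))

  +-congʳ-[mod] : ∀ a {b c d} → b ≡ c [mod d ] → b + a ≡ c + a [mod d ]
  +-congʳ-[mod] a b≡c = +-cong-[mod] b≡c (≡⇒≡[mod] _ (refl {x = a}))

  -‿cong-[mod] : ∀ {a b d} → a ≡ b [mod d ] → - a ≡ - b [mod d ]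
  -‿cong-[mod] {a} {b} [mod]⟨ d∣a-b ⟩ = [mod]⟨ subst (_ ∣_) (negate a b) (∣m⇒∣-m d∣a-b) ⟩
    where
    negate : ∀ a b → - (a - b) ≡ - a - - b
    negate = solve-∀

  +-*-[mod] : ∀ a k d → a + k * d ≡ a [mod d ]
  +-*-[mod] a k d = [mod]⟨ divides k (cancel a k d) ⟩
    where
    cancel : ∀ a k d → a + k * d - a ≡ k * d
    cancel = solve-∀

  *-cong-[mod] : ∀ k {a b d} → a ≡ b [mod d ] → k * a ≡ k * b [mod k * d ]
  *-cong-[mod] k {a} {b} [mod]⟨ d∣a-b ⟩ = [mod]⟨ subst (_ ∣_) (distrib k a b) (*-monoʳ-∣ k d∣a-b) ⟩
    where
    distrib : ∀ k a b → k * (a - b) ≡ k * a - k * b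
    distrib = solve-∀

  *-cancel-[mod] : ∀ k {a b d} .{{_ : ℤ.NonZero k}} → k * a ≡ k * b [mod k * d ] → a ≡ b [mod d ]
  *-cancel-[mod] k {a} {b} [mod]⟨ kd∣ka-kb ⟩ =
    [mod]⟨ *-cancelˡ-∣ k (subst (_ ∣_) (distrib k a b) kd∣ka-kb) ⟩
    where
    distrib : ∀ k a b → k * a - k * b ≡ k * (a - b)
    distrib = solve-∀

  ∑-cong-[mod] : ∀ k {f g : ℕ → ℤ} {d} → (∀ r → r ℕ.< k → f r ≡ g r [mod d ]) → ∑ k f ≡ ∑ k g [mod d ]
  ∑-cong-[mod] zero    f≡g = ≡⇒≡[mod] _ refl
  ∑-cong-[mod] (suc k) f≡g =
    +-cong-[mod] (f≡g 0 (s≤s z≤n)) (∑-cong-[mod] k (λ r r<k → f≡g (suc r) (s≤s r<k)))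

  IsPlusMinusOne : ℤ → Set
  IsPlusMinusOne u = u ≡ 1ℤ ⊎ u ≡ - 1ℤ

  ±1-square : ∀ {u} → IsPlusMinusOne u → u * u ≡ 1ℤ
  ±1-square (inj₁ refl) = refl
  ±1-square (inj₂ refl) = refl

  ±1-neg : ∀ {u} → IsPlusMinusOne u → IsPlusMinusOne (- u)
  ±1-neg (inj₁ refl) = inj₂ refl
  ±1-neg (inj₂ refl) = inj₁ refl

  ±1-* : ∀ {u v} → IsPlusMinusOne u → IsPlusMinusOne v → IsPlusMinusOne (u * v)
  ±1-* (inj₁ refl) (inj₁ refl) = inj₁ refl
  ±1-* (inj₁ refl) (inj₂ refl) = inj₂ refl
  ±1-* (inj₂ refl) (inj₁ refl) = inj₂ refl
  ±1-* (inj₂ refl) (inj₂ refl) = inj₁ refl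

  ±1-*-[mod4] : ∀ {u v} → IsPlusMinusOne u → IsPlusMinusOne v → u * v ≡ u + v - 1ℤ [mod + 4 ]
  ±1-*-[mod4] (inj₁ refl) (inj₁ refl) = ≡⇒≡[mod] _ refl
  ±1-*-[mod4] (inj₁ refl) (inj₂ refl) = ≡⇒≡[mod] _ refl
  ±1-*-[mod4] (inj₂ refl) (inj₁ refl) = ≡⇒≡[mod] _ refl
  ±1-*-[mod4] (inj₂ refl) (inj₂ refl) = [mod]⟨ divides 1ℤ refl ⟩

  ±1-double-[mod4] : ∀ {u} → IsPlusMinusOne u → u + u ≡ + 2 [mod + 4 ]
  ±1-double-[mod4] (inj₁ refl) = ≡⇒≡[mod] _ refl
  ±1-double-[mod4] (inj₂ refl) = [mod]⟨ divides (- 1ℤ) refl ⟩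

  4∤2 : ¬ (+ 4 ∣ + 2)
  4∤2 (divides (+ zero)     ())
  4∤2 (divides (+ suc q)    ())
  4∤2 (divides ℤ.-[1+ q ]   ())

  ±1-[mod4]-injective : ∀ {u v} → IsPlusMinusOne u → IsPlusMinusOne v → u ≡ v [mod + 4 ] → u ≡ v
  ±1-[mod4]-injective (inj₁ refl) (inj₁ refl) _                  = refl
  ±1-[mod4]-injective (inj₁ refl) (inj₂ refl) [mod]⟨ 4∣2 ⟩        = contradiction 4∣2 4∤2
  ±1-[mod4]-injective (inj₂ refl) (inj₁ refl) u≡v                =
    sym (±1-[mod4]-injective (inj₁ refl) (inj₂ refl) ([mod]-sym u≡v))
  ±1-[mod4]-injective (inj₂ refl) (inj₂ refl) _                  = refl

  ±1-product : ∀ {xs} → All IsPlusMinusOne xs → IsPlusMinusOne (foldr _*_ 1ℤ xs)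
  ±1-product []         = inj₁ refl
  ±1-product (px ∷ pxs) = ±1-* px (±1-product pxs)

  ±1-sum-[mod4] : ∀ {xs} → All IsPlusMinusOne xs →
                  foldr _+_ 0ℤ xs ≡ + length xs + foldr _*_ 1ℤ xs - 1ℤ [mod + 4 ]
  ±1-sum-[mod4] []                  = ≡⇒≡[mod] _ refl
  ±1-sum-[mod4] {x ∷ xs} (px ∷ pxs) = begin
    x + foldr _+_ 0ℤ xs                      ≈⟨ +-congˡ-[mod] x (±1-sum-[mod4] pxs) ⟩
    x + (+ length xs + p - 1ℤ)               ≡⟨ regroup x (+ length xs) p ⟩
    (1ℤ + + length xs) + (x + p - 1ℤ) - 1ℤ   ≈⟨ +-congʳ-[mod] (- 1ℤ) (+-cong-[mod]
                                                  (≡⇒≡[mod] _ (sym (ℤₚ.pos-+ 1 (length xs))))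
                                                  ([mod]-sym (±1-*-[mod4] px (±1-product pxs)))) ⟩
    + suc (length xs) + x * p - 1ℤ           ∎
    where
    open SetoidReasoning ([mod]-setoid (+ 4))
    p = foldr _*_ 1ℤ xs
    regroup : ∀ x l p → x + (l + p - 1ℤ) ≡ (1ℤ + l) + (x + p - 1ℤ) - 1ℤ
    regroup = solve-∀

  ±1-product≡1 : ∀ {xs} → All IsPlusMinusOne xs → + length xs ≡ 0ℤ [mod + 4 ] →
                 foldr _+_ 0ℤ xs ≡ 0ℤ [mod + 4 ] → foldr _*_ 1ℤ xs ≡ 1ℤ
  ±1-product≡1 {xs} pxs length≡0 sum≡0 = ±1-[mod4]-injective (±1-product pxs) (inj₁ refl) (begin
    p                             ≡⟨ shift p ⟩
    0ℤ + p - 1ℤ + 1ℤ              ≈⟨ +-congʳ-[mod] 1ℤ (+-congʳ-[mod] (- 1ℤ)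
                                       (+-congʳ-[mod] p ([mod]-sym length≡0))) ⟩
    + length xs + p - 1ℤ + 1ℤ     ≈⟨ +-congʳ-[mod] 1ℤ ([mod]-sym (±1-sum-[mod4] pxs)) ⟩
    foldr _+_ 0ℤ xs + 1ℤ          ≈⟨ +-congʳ-[mod] 1ℤ sum≡0 ⟩
    1ℤ                            ∎)
    where
    open SetoidReasoning ([mod]-setoid (+ 4))
    p = foldr _*_ 1ℤ xs
    shift : ∀ p → p ≡ 0ℤ + p - 1ℤ + 1ℤ
    shift = solve-∀

  *≡-1⇒≡-neg : ∀ {α β} → IsPlusMinusOne β → α * β ≡ - 1ℤ → α ≡ - β
  *≡-1⇒≡-neg {α} {β} pβ αβ≡-1 = begin
    α              ≡⟨ ℤₚ.*-identityʳ α ⟨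
    α * 1ℤ         ≡⟨ cong (α *_) (±1-square pβ) ⟨
    α * (β * β)    ≡⟨ ℤₚ.*-assoc α β β ⟨
    α * β * β      ≡⟨ cong (_* β) αβ≡-1 ⟩
    - 1ℤ * β       ≡⟨ ℤₚ.-1*i≡-i β ⟩
    - β            ∎
    where open ≡-Reasoning

  sign-rule : ∀ {aκ ak b0 c0 d0 bk ck dk} →
              All IsPlusMinusOne (aκ ∷ ak ∷ b0 ∷ c0 ∷ d0 ∷ bk ∷ ck ∷ dk ∷ []) →
              aκ + ak + b0 + c0 + d0 - bk - ck - dk ≡ 0ℤ [mod + 4 ] →
              ak * bk * ck * dk ≡ - (aκ * b0 * c0 * d0)
  sign-rule {aκ} {ak} {b0} {c0} {d0} {bk} {ck} {dk}
            (paκ ∷ pak ∷ pb0 ∷ pc0 ∷ pd0 ∷ pbk ∷ pck ∷ pdk ∷ []) sum≡0 =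
    *≡-1⇒≡-neg (±1-* (±1-* (±1-* paκ pb0) pc0) pd0) (begin
      (ak * bk * ck * dk) * (aκ * b0 * c0 * d0)  ≡⟨ product-signs aκ ak b0 c0 d0 bk ck dk ⟩
      - foldr _*_ 1ℤ signs                        ≡⟨ cong -_ (±1-product≡1 psigns [mod]⟨ divides (+ 2) refl ⟩
                                                                            sum-signs≡0) ⟩
      - 1ℤ                                        ∎)
    where
    open ≡-Reasoning
    signs = aκ ∷ ak ∷ b0 ∷ c0 ∷ d0 ∷ - bk ∷ - ck ∷ - dk ∷ []
    psigns : All IsPlusMinusOne signs
    psigns = paκ ∷ pak ∷ pb0 ∷ pc0 ∷ pd0 ∷ ±1-neg pbk ∷ ±1-neg pck ∷ ±1-neg pdk ∷ []
    sum-signs : ∀ aκ ak b0 c0 d0 bk ck dk →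
                aκ + (ak + (b0 + (c0 + (d0 + (- bk + (- ck + (- dk + 0ℤ)))))))
                  ≡ aκ + ak + b0 + c0 + d0 - bk - ck - dk
    sum-signs = solve-∀
    sum-signs≡0 : foldr _+_ 0ℤ signs ≡ 0ℤ [mod + 4 ]
    sum-signs≡0 = [mod]-trans (≡⇒≡[mod] _ (sum-signs aκ ak b0 c0 d0 bk ck dk)) sum≡0
    product-signs : ∀ aκ ak b0 c0 d0 bk ck dk →
                    (ak * bk * ck * dk) * (aκ * b0 * c0 * d0)
                      ≡ - (aκ * (ak * (b0 * (c0 * (d0 * (- bk * (- ck * (- dk * 1ℤ))))))))
    product-signs = solve-∀

  scalarId-off-diagonal : ∀ {n} c (i j : Fin n) → toℕ i ≢ toℕ j → scalarId c i j ≡ 0ℤ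
  scalarId-off-diagonal c i j i≢j with toℕ i ℕ.≟ toℕ j
  ... | yes i≡j = contradiction i≡j i≢j
  ... | no  _   = refl

  -- Sequences indexed by ℤ/n are modelled as functions on ℕ that only depend on the index mod n.
  module Cyclic (m : ℕ) where

    n : ℕ
    n = suc m

    Periodic : (ℕ → ℤ) → Set
    Periodic f = ∀ x y → x % n ≡ y % n → f x ≡ f y

    %-≡ : ∀ x y p q → x ℕ.+ p ℕ.* n ≡ y ℕ.+ q ℕ.* n → x % n ≡ y % n
    %-≡ x y p q eq = trans (sym ([m+kn]%n≡m%n x p n)) (trans (cong (_% n) eq) ([m+kn]%n≡m%n y q n))

    +-congˡ-% : ∀ c x y → x % n ≡ y % n → (c ℕ.+ x) % n ≡ (c ℕ.+ y) % n
    +-congˡ-% c x y x≡y = begin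
      (c ℕ.+ x) % n            ≡⟨ %-distribˡ-+ c x n ⟩
      (c % n ℕ.+ x % n) % n    ≡⟨ cong (λ i → (c % n ℕ.+ i) % n) x≡y ⟩
      (c % n ℕ.+ y % n) % n    ≡⟨ %-distribˡ-+ c y n ⟨
      (c ℕ.+ y) % n            ∎
      where open ≡-Reasoning

    +-congʳ-% : ∀ c x y → x % n ≡ y % n → (x ℕ.+ c) % n ≡ (y ℕ.+ c) % n
    +-congʳ-% c x y x≡y = begin
      (x ℕ.+ c) % n   ≡⟨ cong (_% n) (ℕₚ.+-comm x c) ⟩
      (c ℕ.+ x) % n   ≡⟨ +-congˡ-% c x y x≡y ⟩
      (c ℕ.+ y) % n   ≡⟨ cong (_% n) (ℕₚ.+-comm c y) ⟩
      (y ℕ.+ c) % n   ∎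
      where open ≡-Reasoning

    *-congʳ-% : ∀ c x y → x % n ≡ y % n → (x ℕ.* c) % n ≡ (y ℕ.* c) % n
    *-congʳ-% c x y x≡y = begin
      (x ℕ.* c) % n              ≡⟨ %-distribˡ-* x c n ⟩
      (x % n ℕ.* (c % n)) % n    ≡⟨ cong (λ i → (i ℕ.* (c % n)) % n) x≡y ⟩
      (y % n ℕ.* (c % n)) % n    ≡⟨ %-distribˡ-* y c n ⟨
      (y ℕ.* c) % n              ∎
      where open ≡-Reasoning

    -- Multiplication by m ≡ -1 is negation modulo n; unlike a truncated subtraction it is a
    -- polynomial, so the index identities below are discharged by the ring solver.
    neg : ℕ → ℕ
    neg r = r ℕ.* m

    neg-involutive : ∀ x → neg (neg x) % n ≡ x % n
    neg-involutive x = %-≡ (x ℕ.* m ℕ.* m) x x (x ℕ.* m) (identity x m)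
      where
      identity : ∀ x m → x ℕ.* m ℕ.* m ℕ.+ x ℕ.* suc m ≡ x ℕ.+ x ℕ.* m ℕ.* suc m
      identity = ℕSolver.solve-∀

    neg-complement : ∀ x y → x ℕ.+ y ≡ n → x % n ≡ neg y % n
    neg-complement x y x+y≡n = %-≡ x (neg y) y 1 (begin
      x ℕ.+ y ℕ.* n           ≡⟨ split x y m ⟩
      (x ℕ.+ y) ℕ.+ y ℕ.* m   ≡⟨ cong (ℕ._+ y ℕ.* m) x+y≡n ⟩
      n ℕ.+ y ℕ.* m           ≡⟨ swap y m ⟩
      y ℕ.* m ℕ.+ 1 ℕ.* n     ∎)
      where
      open ≡-Reasoning
      split : ∀ x y m → x ℕ.+ y ℕ.* suc m ≡ (x ℕ.+ y) ℕ.+ y ℕ.* m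
      split = ℕSolver.solve-∀
      swap : ∀ y m → suc m ℕ.+ y ℕ.* m ≡ y ℕ.* m ℕ.+ 1 ℕ.* suc m
      swap = ℕSolver.solve-∀

    shift-periodic : ∀ {f} c → Periodic f → Periodic (λ r → f (c ℕ.+ r))
    shift-periodic c f-per x y x≡y = f-per (c ℕ.+ x) (c ℕ.+ y) (+-congˡ-% c x y x≡y)

    neg-periodic : ∀ {f} → Periodic f → Periodic (f ∘ neg)
    neg-periodic f-per x y x≡y = f-per (neg x) (neg y) (*-congʳ-% m x y x≡y)

    *-periodic : ∀ {f g} → Periodic f → Periodic g → Periodic (λ r → f r * g r)
    *-periodic f-per g-per x y x≡y = cong₂ _*_ (f-per x y x≡y) (g-per x y x≡y)

    SymmetricSequence : (ℕ → ℤ) → Set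
    SymmetricSequence x = ∀ r → r ℕ.< n → x (neg r) ≡ x r

    SkewSequence : (ℕ → ℤ) → Set
    SkewSequence a = a 0 ≡ 1ℤ × (∀ r → suc r ℕ.< n → a (suc r) ≡ - a (neg (suc r)))

    ∑-rotate₁ : ∀ {f} → Periodic f → ∑ n (f ∘ suc) ≡ ∑ n f
    ∑-rotate₁ {f} f-per = begin
      ∑ n (f ∘ suc)          ≡⟨ ∑-snoc m (f ∘ suc) ⟩
      ∑ m (f ∘ suc) + f n    ≡⟨ cong (_+_ (∑ m (f ∘ suc))) (f-per n 0 (%-≡ n 0 0 1 refl)) ⟩
      ∑ m (f ∘ suc) + f 0    ≡⟨ ℤₚ.+-comm _ (f 0) ⟩
      ∑ n f                  ∎
      where open ≡-Reasoning

    ∑-rotate : ∀ {f} → Periodic f → ∀ c → ∑ n f ≡ ∑ n (λ r → f (c ℕ.+ r))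
    ∑-rotate f-per zero    = refl
    ∑-rotate f-per (suc c) = trans (sym (∑-rotate₁ f-per)) (∑-rotate (shift-periodic 1 f-per) c)

    ∑-reflect : ∀ {f} → Periodic f → ∑ n f ≡ ∑ n (f ∘ neg)
    ∑-reflect {f} f-per = begin
      ∑ n f                           ≡⟨ ∑-rotate₁ f-per ⟨
      ∑ n (f ∘ suc)                   ≡⟨ ∑-reverse n (f ∘ suc) ⟩
      ∑ n (λ r → f (suc (m ℕ.∸ r)))   ≡⟨ ∑-cong n (λ r r<n → f-per (suc (m ℕ.∸ r)) (neg r)
                                           (neg-complement (suc (m ℕ.∸ r)) r (complement r<n))) ⟩
      ∑ n (f ∘ neg)                   ∎
      where
      open ≡-Reasoning
      complement : ∀ {r} → r ℕ.< n → suc (m ℕ.∸ r) ℕ.+ r ≡ n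
      complement (s≤s r≤m) = cong suc (ℕₚ.m∸n+n≡m r≤m)

    convolution : (ℕ → ℤ) → (ℕ → ℤ) → ℕ → ℤ
    convolution x y c = ∑ n (λ l → x (c ℕ.+ l) * y (neg l))

    correlation : (ℕ → ℤ) → (ℕ → ℤ) → ℕ → ℤ
    correlation x y c = ∑ n (λ l → x (c ℕ.+ l) * y l)

    convolution-periodic : ∀ {x y} → Periodic x → Periodic (convolution x y)
    convolution-periodic {x} {y} x-per c c′ c≡c′ =
      ∑-ext n (λ l → cong (_* y (neg l)) (x-per (c ℕ.+ l) (c′ ℕ.+ l) (+-congʳ-% l c c′ c≡c′)))

    correlation-skew : ∀ {a} → SkewSequence a → ∀ c → correlation a a c ≡ + 2 * a c - convolution a a c
    correlation-skew {a} (a0≡1 , a-skew) c = begin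
      a (c ℕ.+ 0) * a 0 + ∑ m (λ r → a (c ℕ.+ suc r) * a (suc r))
        ≡⟨ cong₂ _+_ (trans (cong₂ _*_ (cong a (ℕₚ.+-identityʳ c)) a0≡1) (ℤₚ.*-identityʳ (a c)))
                     (trans (∑-cong m flip-sign) (∑-neg m _)) ⟩
      a c - rest
        ≡⟨ reflect (a c) rest ⟩
      + 2 * a c - (a c * 1ℤ + rest)
        ≡⟨ cong (λ v → + 2 * a c - (v + rest)) (cong₂ _*_ (cong a (ℕₚ.+-identityʳ c)) a0≡1) ⟨
      + 2 * a c - convolution a a c
        ∎
      where
      open ≡-Reasoning
      rest : ℤ
      rest = ∑ m (λ r → a (c ℕ.+ suc r) * a (neg (suc r)))
      flip-sign : ∀ r → r ℕ.< m → a (c ℕ.+ suc r) * a (suc r) ≡ - (a (c ℕ.+ suc r) * a (neg (suc r)))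
      flip-sign r r<m = trans (cong (a (c ℕ.+ suc r) *_) (a-skew r (s≤s r<m)))
                              (sym (ℤₚ.neg-distribʳ-* (a (c ℕ.+ suc r)) (a (neg (suc r)))))
      reflect : ∀ u v → u - v ≡ + 2 * u - (u * 1ℤ + v)
      reflect = solve-∀

    row : Matrix n → ℕ → ℤ
    row X r = X fzero (r mod n)

    toℕ-mod : ∀ r → toℕ (r mod n) ≡ r % n
    toℕ-mod r = Finₚ.toℕ-fromℕ< _

    row-periodic : ∀ X → Periodic (row X)
    row-periodic X x y x≡y =
      cong (X fzero) (Finₚ.toℕ-injective (trans (toℕ-mod x) (trans x≡y (sym (toℕ-mod y)))))

    row-toℕ : ∀ X j → row X (toℕ j) ≡ X fzero j
    row-toℕ X j =
      cong (X fzero) (Finₚ.toℕ-injective (trans (toℕ-mod (toℕ j)) (m<n⇒m%n≡m (Finₚ.toℕ<n j))))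

    row-±1 : ∀ {X} → PlusMinusOne X → ∀ r → IsPlusMinusOne (row X r)
    row-±1 X-pm r = X-pm fzero (r mod n)

    circulant-entry : ∀ {X} → Circulant X → ∀ i j → X i j ≡ row X (toℕ j ℕ.+ neg (toℕ i))
    circulant-entry {X} X-circ i j = shift (toℕ i) i j refl
      where
      shift : ∀ r i j → toℕ i ≡ r → X i j ≡ row X (toℕ j ℕ.+ neg r)
      shift zero    i j i≡0   = begin
        X i j                  ≡⟨ cong (λ i → X i j) (Finₚ.toℕ-injective i≡0) ⟩
        X fzero j              ≡⟨ row-toℕ X j ⟨
        row X (toℕ j)          ≡⟨ cong (row X) (ℕₚ.+-identityʳ (toℕ j)) ⟨
        row X (toℕ j ℕ.+ 0)    ∎
        where open ≡-Reasoning
      shift (suc r) i j i≡1+r = begin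
        X i j                               ≡⟨ X-circ i j ⟩
        X (predMod i) (predMod j)           ≡⟨ shift r (predMod i) (predMod j) pred-i≡r ⟩
        row X (toℕ (predMod j) ℕ.+ neg r)   ≡⟨ undo-pred ⟩
        row X (toℕ j ℕ.+ m ℕ.+ neg r)       ≡⟨ cong (row X) (ℕₚ.+-assoc (toℕ j) m (neg r)) ⟩
        row X (toℕ j ℕ.+ neg (suc r))       ∎
        where
        open ≡-Reasoning
        pred-j≡j+m : toℕ (predMod j) % n ≡ (toℕ j ℕ.+ m) % n
        pred-j≡j+m = trans (cong (_% n) (toℕ-mod (toℕ j ℕ.+ m))) (m%n%n≡m%n (toℕ j ℕ.+ m) n)
        undo-pred : row X (toℕ (predMod j) ℕ.+ neg r) ≡ row X (toℕ j ℕ.+ m ℕ.+ neg r)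
        undo-pred = row-periodic X (toℕ (predMod j) ℕ.+ neg r) (toℕ j ℕ.+ m ℕ.+ neg r)
                                   (+-congʳ-% (neg r) (toℕ (predMod j)) (toℕ j ℕ.+ m) pred-j≡j+m)
        r<n : r ℕ.< n
        r<n = ℕₚ.<-trans (ℕₚ.n<1+n r) (subst (ℕ._< n) i≡1+r (Finₚ.toℕ<n i))
        pred-i≡r : toℕ (predMod i) ≡ r
        pred-i≡r = begin
          toℕ (predMod i)      ≡⟨ toℕ-mod (toℕ i ℕ.+ m) ⟩
          (toℕ i ℕ.+ m) % n    ≡⟨ cong (λ i → (i ℕ.+ m) % n) i≡1+r ⟩
          suc (r ℕ.+ m) % n    ≡⟨ cong (_% n) (ℕₚ.+-suc r m) ⟨
          (r ℕ.+ n) % n        ≡⟨ [m+n]%n≡m%n r n ⟩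
          r % n                ≡⟨ m<n⇒m%n≡m r<n ⟩
          r                    ∎

    circulant-·-entry : ∀ X {Y} → Circulant Y → ∀ K →
                        (X · Y) fzero K ≡ convolution (row Y) (row X) (toℕ K)
    circulant-·-entry X {Y} Y-circ K = begin
      (X · Y) fzero K                 ≡⟨ Σ[<]≡∑ n f (λ l → cong₂ _*_ (sym (row-toℕ X l))
                                                                   (circulant-entry Y-circ l K)) ⟩
      ∑ n f                           ≡⟨ ∑-reflect f-periodic ⟩
      ∑ n (f ∘ neg)                   ≡⟨ ∑-ext n swap-neg-neg ⟩
      convolution (row Y) (row X) κ   ∎
      where
      open ≡-Reasoning
      κ = toℕ K
      f : ℕ → ℤ
      f l = row X l * row Y (κ ℕ.+ neg l)
      f-periodic : Periodic f
      f-periodic = *-periodic (row-periodic X) (neg-periodic (shift-periodic κ (row-periodic Y)))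
      y-neg-neg : ∀ l → row Y (κ ℕ.+ neg (neg l)) ≡ row Y (κ ℕ.+ l)
      y-neg-neg l = row-periodic Y (κ ℕ.+ neg (neg l)) (κ ℕ.+ l) (+-congˡ-% κ (neg (neg l)) l (neg-involutive l))
      swap-neg-neg : ∀ l → f (neg l) ≡ row Y (κ ℕ.+ l) * row X (neg l)
      swap-neg-neg l = trans (ℤₚ.*-comm (row X (neg l)) (row Y (κ ℕ.+ neg (neg l))))
                             (cong (_* row X (neg l)) (y-neg-neg l))

    circulant-·ᵀ-entry : ∀ X {Y} → Circulant Y → ∀ K →
                         (X · transpose Y) fzero K ≡ correlation (row X) (row Y) (toℕ K)
    circulant-·ᵀ-entry X {Y} Y-circ K = begin
      (X · transpose Y) fzero K       ≡⟨ Σ[<]≡∑ n f (λ l → cong₂ _*_ (sym (row-toℕ X l)) (entry l)) ⟩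
      ∑ n f                           ≡⟨ ∑-rotate f-periodic κ ⟩
      ∑ n (λ l → f (κ ℕ.+ l))         ≡⟨ ∑-ext n (λ l → cong (row X (κ ℕ.+ l) *_) (y-shift l)) ⟩
      correlation (row X) (row Y) κ   ∎
      where
      open ≡-Reasoning
      κ = toℕ K
      f : ℕ → ℤ
      f l = row X l * row Y (neg κ ℕ.+ l)
      f-periodic : Periodic f
      f-periodic = *-periodic (row-periodic X) (shift-periodic (neg κ) (row-periodic Y))
      entry : ∀ l → Y K l ≡ row Y (neg κ ℕ.+ toℕ l)
      entry l = trans (circulant-entry Y-circ K l) (cong (row Y) (ℕₚ.+-comm (toℕ l) (neg κ)))
      identity : ∀ κ l m → κ ℕ.* m ℕ.+ (κ ℕ.+ l) ℕ.+ 0 ℕ.* suc m ≡ l ℕ.+ κ ℕ.* suc m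
      identity = ℕSolver.solve-∀
      y-shift : ∀ l → row Y (neg κ ℕ.+ (κ ℕ.+ l)) ≡ row Y l
      y-shift l = row-periodic Y (neg κ ℕ.+ (κ ℕ.+ l)) l (%-≡ (neg κ ℕ.+ (κ ℕ.+ l)) l 0 κ (identity κ l m))

    ∀Fin⇒∀<n : ∀ {P : ℕ → Set} → (∀ j → P (toℕ j)) → ∀ r → r ℕ.< n → P r
    ∀Fin⇒∀<n {P} P-fin r r<n = subst P (Finₚ.toℕ-fromℕ< r<n) (P-fin (fromℕ< r<n))

    row-symmetric : ∀ {X} → Circulant X → Symmetric X → SymmetricSequence (row X)
    row-symmetric {X} X-circ X-sym = ∀Fin⇒∀<n λ j → begin
      row X (neg (toℕ j))   ≡⟨ circulant-entry X-circ j fzero ⟨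
      X j fzero             ≡⟨ X-sym j fzero ⟩
      X fzero j             ≡⟨ row-toℕ X j ⟨
      row X (toℕ j)         ∎
      where open ≡-Reasoning

    row-skew : ∀ {X} → Circulant X → Skew X → SkewSequence (row X)
    row-skew {X} X-circ (X-diag , X-skew) = X-diag fzero , λ r 1+r<n →
      ∀Fin⇒∀<n {λ s → s ≢ 0 → row X s ≡ - row X (neg s)} nonzero-skew (suc r) 1+r<n (λ ())
      where
      open ≡-Reasoning
      nonzero-skew : ∀ j → toℕ j ≢ 0 → row X (toℕ j) ≡ - row X (neg (toℕ j))
      nonzero-skew j j≢0 = begin
        row X (toℕ j)           ≡⟨ row-toℕ X j ⟩
        X fzero j               ≡⟨ X-skew fzero j (λ 0≡j → j≢0 (sym (cong toℕ 0≡j))) ⟩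
        - X j fzero             ≡⟨ cong -_ (circulant-entry X-circ j fzero) ⟩
        - row X (neg (toℕ j))   ∎

  module Odd (t : ℕ) where
    open Cyclic (2 ℕ.* t) public

    ∑-pair : ∀ {f} → Periodic f → ∑ n f ≡ f 0 + ∑ t (λ s → f (suc s) + f (neg (suc s)))
    ∑-pair {f} f-per = cong (_+_ (f 0)) (begin
      ∑ (2 ℕ.* t) (f ∘ suc)                           ≡⟨ cong (λ k → ∑ (t ℕ.+ k) (f ∘ suc)) (ℕₚ.+-identityʳ t) ⟩
      ∑ (t ℕ.+ t) (f ∘ suc)                           ≡⟨ ∑-split t t (f ∘ suc) ⟩
      ∑ t (f ∘ suc) + ∑ t (λ r → f (suc (t ℕ.+ r)))   ≡⟨ cong (_+_ (∑ t (f ∘ suc))) (∑-reverse t _) ⟩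
      ∑ t (f ∘ suc) + ∑ t (f ∘ mirror)                ≡⟨ cong (_+_ (∑ t (f ∘ suc))) (∑-cong t mirror≡neg) ⟩
      ∑ t (f ∘ suc) + ∑ t (λ r → f (neg (suc r)))     ≡⟨ ∑-+ t (f ∘ suc) (f ∘ neg ∘ suc) ⟨
      ∑ t (λ s → f (suc s) + f (neg (suc s)))         ∎)
      where
      open ≡-Reasoning
      mirror : ℕ → ℕ
      mirror r = suc (t ℕ.+ (t ℕ.∸ suc r))
      complement : ∀ {r} → r ℕ.< t → mirror r ℕ.+ suc r ≡ n
      complement {r} r<t = cong suc (begin
        t ℕ.+ (t ℕ.∸ suc r) ℕ.+ suc r    ≡⟨ ℕₚ.+-assoc t (t ℕ.∸ suc r) (suc r) ⟩
        t ℕ.+ (t ℕ.∸ suc r ℕ.+ suc r)    ≡⟨ cong (t ℕ.+_) (ℕₚ.m∸n+n≡m r<t) ⟩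
        t ℕ.+ t                          ≡⟨ cong (t ℕ.+_) (ℕₚ.+-identityʳ t) ⟨
        2 ℕ.* t                          ∎)
      mirror≡neg : ∀ r → r ℕ.< t → f (mirror r) ≡ f (neg (suc r))
      mirror≡neg r r<t = f-per _ (neg (suc r)) (neg-complement (mirror r) (suc r) (complement r<t))

    suc-<-n : ∀ {s} → s ℕ.< t → suc s ℕ.< n
    suc-<-n s<t = s≤s (ℕₚ.<-≤-trans s<t (ℕₚ.m≤m+n t _))

    ∑-skew : ∀ {a} → Periodic a → SkewSequence a → ∑ n a ≡ 1ℤ
    ∑-skew {a} a-per (a0≡1 , a-skew) = begin
      ∑ n a                                            ≡⟨ ∑-pair a-per ⟩
      a 0 + ∑ t (λ s → a (suc s) + a (neg (suc s)))    ≡⟨ cong₂ _+_ a0≡1 (∑-cong t cancel) ⟩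
      1ℤ + ∑ t (λ _ → 0ℤ)                              ≡⟨ cong (_+_ 1ℤ) (trans (∑-const t 0ℤ)
                                                                                (ℤₚ.*-zeroʳ (+ t))) ⟩
      1ℤ                                               ∎
      where
      open ≡-Reasoning
      cancel : ∀ s → s ℕ.< t → a (suc s) + a (neg (suc s)) ≡ 0ℤ
      cancel s s<t = trans (cong (_+ a (neg (suc s))) (a-skew s (suc-<-n s<t)))
                           (ℤₚ.+-inverseˡ (a (neg (suc s))))

    ∑-symmetric-[mod4] : ∀ {x} → Periodic x → (∀ r → IsPlusMinusOne (x r)) → SymmetricSequence x →
                         ∑ n x ≡ x 0 + + 2 * + t [mod + 4 ]
    ∑-symmetric-[mod4] {x} x-per x-pm x-sym = begin
      ∑ n x                                            ≡⟨ ∑-pair x-per ⟩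
      x 0 + ∑ t (λ s → x (suc s) + x (neg (suc s)))    ≈⟨ +-congˡ-[mod] (x 0) (∑-cong-[mod] t pair≡2) ⟩
      x 0 + ∑ t (λ _ → + 2)                            ≡⟨ cong (_+_ (x 0)) (trans (∑-const t (+ 2))
                                                                                  (ℤₚ.*-comm (+ t) (+ 2))) ⟩
      x 0 + + 2 * + t                                  ∎
      where
      open SetoidReasoning ([mod]-setoid (+ 4))
      pair≡2 : ∀ s → s ℕ.< t → x (suc s) + x (neg (suc s)) ≡ + 2 [mod + 4 ]
      pair≡2 s s<t = [mod]-trans (≡⇒≡[mod] _ (cong (_+_ (x (suc s))) (x-sym (suc s) (suc-<-n s<t))))
                                 (±1-double-[mod4] (x-pm (suc s)))

    ∑-around : ∀ {x} → Periodic x → ∀ k → ∑ n x ≡ x k + ∑ t (λ s → x (k ℕ.+ suc s) + x (k ℕ.+ neg (suc s)))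
    ∑-around {x} x-per k = begin
      ∑ n x                      ≡⟨ ∑-rotate x-per k ⟩
      ∑ n (λ r → x (k ℕ.+ r))    ≡⟨ ∑-pair (shift-periodic k x-per) ⟩
      x (k ℕ.+ 0) + pairs        ≡⟨ cong (λ i → x i + pairs) (ℕₚ.+-identityʳ k) ⟩
      x k + pairs                ∎
      where
      open ≡-Reasoning
      pairs = ∑ t (λ s → x (k ℕ.+ suc s) + x (k ℕ.+ neg (suc s)))

    convolution-double : ∀ {x} → Periodic x → ∀ k →
      convolution x x (2 ℕ.* k) ≡ x k * x k + + 2 * ∑ t (λ s → x (k ℕ.+ suc s) * x (k ℕ.+ neg (suc s)))
    convolution-double {x} x-per k = begin
      ∑ n g                                            ≡⟨ ∑-rotate g-per (neg k) ⟩
      ∑ n (λ r → g (neg k ℕ.+ r))                      ≡⟨ ∑-ext n recentre ⟩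
      ∑ n h                                            ≡⟨ ∑-pair h-per ⟩
      h 0 + ∑ t (λ s → h (suc s) + h (neg (suc s)))    ≡⟨ cong₂ _+_ h0 (∑-ext t (λ s →
                                                            cong (_+_ (h (suc s))) (h-neg (suc s)))) ⟩
      x k * x k + ∑ t (λ s → h (suc s) + h (suc s))    ≡⟨ cong (_+_ (x k * x k))
                                                            (trans (∑-ext t (λ s → double (h (suc s))))
                                                                   (∑-*ˡ t (+ 2) (h ∘ suc))) ⟩
      x k * x k + + 2 * ∑ t (h ∘ suc)                  ∎
      where
      open ≡-Reasoning
      g h : ℕ → ℤ
      g l = x (2 ℕ.* k ℕ.+ l) * x (neg l)
      h r = x (k ℕ.+ r) * x (k ℕ.+ neg r)
      g-per : Periodic g
      g-per = *-periodic (shift-periodic (2 ℕ.* k) x-per) (neg-periodic x-per)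
      h-per : Periodic h
      h-per = *-periodic (shift-periodic k x-per) (neg-periodic (shift-periodic k x-per))
      shifted : ∀ k r m → 2 ℕ.* k ℕ.+ (k ℕ.* m ℕ.+ r) ℕ.+ 0 ℕ.* suc m ≡ k ℕ.+ r ℕ.+ k ℕ.* suc m
      shifted = ℕSolver.solve-∀
      reflected : ∀ k r m → (k ℕ.* m ℕ.+ r) ℕ.* m ℕ.+ k ℕ.* suc m ≡ k ℕ.+ r ℕ.* m ℕ.+ k ℕ.* m ℕ.* suc m
      reflected = ℕSolver.solve-∀
      recentre : ∀ r → g (neg k ℕ.+ r) ≡ h r
      recentre r = cong₂ _*_
        (x-per _ (k ℕ.+ r) (%-≡ _ (k ℕ.+ r) 0 k (shifted k r (2 ℕ.* t))))
        (x-per _ (k ℕ.+ neg r) (%-≡ _ (k ℕ.+ neg r) k (neg k) (reflected k r (2 ℕ.* t))))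
      h0 : h 0 ≡ x k * x k
      h0 = cong (λ i → x i * x i) (ℕₚ.+-identityʳ k)
      h-neg : ∀ r → h (neg r) ≡ h r
      h-neg r = trans (cong (x (k ℕ.+ neg r) *_) (x-per _ (k ℕ.+ r) (+-congˡ-% k _ r (neg-involutive r))))
                      (ℤₚ.*-comm (x (k ℕ.+ neg r)) (x (k ℕ.+ r)))
      double : ∀ u → u + u ≡ + 2 * u
      double = solve-∀

    convolution-double-[mod8] : ∀ {x} → Periodic x → (∀ r → IsPlusMinusOne (x r)) → ∀ k →
      convolution x x (2 ℕ.* k) ≡ 1ℤ + + 2 * (∑ n x - x k) - + 2 * + t [mod + 8 ]
    convolution-double-[mod8] {x} x-per x-pm k = begin
      convolution x x (2 ℕ.* k)                  ≡⟨ convolution-double x-per k ⟩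
      x k * x k + + 2 * ∑ t (λ s → y s * z s)    ≡⟨ cong (_+ + 2 * ∑ t (λ s → y s * z s)) (±1-square (x-pm k)) ⟩
      1ℤ + + 2 * ∑ t (λ s → y s * z s)           ≈⟨ +-congˡ-[mod] 1ℤ (*-cong-[mod] (+ 2) (∑-cong-[mod] t λ s _ →
                                                      ±1-*-[mod4] (x-pm (k ℕ.+ suc s)) (x-pm (k ℕ.+ neg (suc s))))) ⟩
      1ℤ + + 2 * ∑ t (λ s → y s + z s - 1ℤ)      ≡⟨ cong (λ v → 1ℤ + + 2 * v)
                                                      (trans (∑-+ t _ _) (cong (_+_ pairs) (∑-const t (- 1ℤ)))) ⟩
      1ℤ + + 2 * (pairs + + t * - 1ℤ)            ≡⟨ cong (λ v → 1ℤ + + 2 * (v + + t * - 1ℤ)) pairs≡ ⟩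
      1ℤ + + 2 * (∑ n x - x k + + t * - 1ℤ)      ≡⟨ regroup (∑ n x - x k) (+ t) ⟩
      1ℤ + + 2 * (∑ n x - x k) - + 2 * + t       ∎
      where
      open SetoidReasoning ([mod]-setoid (+ 8))
      y z : ℕ → ℤ
      y s = x (k ℕ.+ suc s)
      z s = x (k ℕ.+ neg (suc s))
      pairs = ∑ t (λ s → y s + z s)
      isolate : ∀ u v → v ≡ u + v - u
      isolate = solve-∀
      pairs≡ : pairs ≡ ∑ n x - x k
      pairs≡ = trans (isolate (x k) pairs) (cong (_- x k) (sym (∑-around x-per k)))
      regroup : ∀ v t → 1ℤ + + 2 * (v + t * - 1ℤ) ≡ 1ℤ + + 2 * v - + 2 * t
      regroup = solve-∀

    double-%-≢0 : ∀ {k} → 0 ℕ.< k → k ℕ.< n → (2 ℕ.* k) % n ≢ 0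
    double-%-≢0 {k} 0<k k<n 2k%n≡0 with ℕ∣.m%n≡0⇒n∣m (2 ℕ.* k) n 2k%n≡0
    ... | ℕ∣.divides zero          2k≡0  = ℕₚ.<-irrefl (sym (ℕₚ.m+n≡0⇒m≡0 k 2k≡0)) 0<k
    ... | ℕ∣.divides (suc zero)    2k≡n  = ℕₚ.even≢odd k t (trans 2k≡n (ℕₚ.+-identityʳ n))
    ... | ℕ∣.divides (suc (suc q)) 2k≡qn =
      ℕₚ.<-irrefl 2k≡qn (ℕₚ.<-≤-trans (ℕₚ.*-monoʳ-< 2 k<n) (ℕₚ.*-monoˡ-≤ n (s≤s (s≤s (z≤n {q})))))

    double-mod : ∀ k → toℕ ((2 ℕ.* k) mod n) % n ≡ (2 ℕ.* k) % n
    double-mod k = trans (cong (_% n) (toℕ-mod (2 ℕ.* k))) (m%n%n≡m%n (2 ℕ.* k) n)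

    skew-gram-[mod8] : ∀ {A} → PlusMinusOne A → Circulant A → Skew A → ∀ k →
      (A · transpose A) fzero ((2 ℕ.* toℕ k) mod n)
        ≡ + 2 * (A fzero ((2 ℕ.* toℕ k) mod n) + A fzero k) - + 3 + + 2 * + t [mod + 8 ]
    skew-gram-[mod8] {A} A-pm A-circ A-skew k = begin
      (A · transpose A) fzero K
        ≡⟨ circulant-·ᵀ-entry A A-circ K ⟩
      correlation a a (toℕ K)
        ≡⟨ correlation-skew {a} a-skew (toℕ K) ⟩
      + 2 * a (toℕ K) - convolution a a (toℕ K)
        ≡⟨ cong₂ (λ u v → + 2 * u - v) (row-toℕ A K)
                 (convolution-periodic {y = a} (row-periodic A) (toℕ K) (2 ℕ.* toℕ k) (double-mod (toℕ k))) ⟩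
      + 2 * aK - convolution a a (2 ℕ.* toℕ k)
        ≈⟨ +-congˡ-[mod] (+ 2 * aK)
             (-‿cong-[mod] (convolution-double-[mod8] (row-periodic A) (row-±1 A-pm) (toℕ k))) ⟩
      + 2 * aK - (1ℤ + + 2 * (∑ n a - a (toℕ k)) - + 2 * + t)
        ≡⟨ cong₂ (λ u v → + 2 * aK - (1ℤ + + 2 * (u - v) - + 2 * + t))
                 (∑-skew (row-periodic A) a-skew) (row-toℕ A k) ⟩
      + 2 * aK - (1ℤ + + 2 * (1ℤ - A fzero k) - + 2 * + t)
        ≡⟨ regroup aK (A fzero k) (+ t) ⟩
      + 2 * (aK + A fzero k) - + 3 + + 2 * + t
        ∎
      where
      open SetoidReasoning ([mod]-setoid (+ 8))
      K = (2 ℕ.* toℕ k) mod n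
      a = row A
      aK = A fzero K
      a-skew : SkewSequence a
      a-skew = row-skew A-circ A-skew
      regroup : ∀ u v t → + 2 * u - (1ℤ + + 2 * (1ℤ - v) - + 2 * t) ≡ + 2 * (u + v) - + 3 + + 2 * t
      regroup = solve-∀

    symmetric-square-[mod8] : ∀ {X} → PlusMinusOne X → Circulant X → Symmetric X → ∀ k →
      (X · X) fzero ((2 ℕ.* toℕ k) mod n) ≡ 1ℤ + + 2 * (X fzero fzero - X fzero k) + + 2 * + t [mod + 8 ]
    symmetric-square-[mod8] {X} X-pm X-circ X-sym k = begin
      (X · X) fzero K
        ≡⟨ circulant-·-entry X X-circ K ⟩
      convolution x x (toℕ K)
        ≡⟨ convolution-periodic {y = x} (row-periodic X) (toℕ K) (2 ℕ.* toℕ k) (double-mod (toℕ k)) ⟩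
      convolution x x (2 ℕ.* toℕ k)
        ≈⟨ convolution-double-[mod8] (row-periodic X) (row-±1 X-pm) (toℕ k) ⟩
      1ℤ + + 2 * (∑ n x - x (toℕ k)) - + 2 * + t
        ≡⟨ cong (λ v → 1ℤ + + 2 * (∑ n x - v) - + 2 * + t) (row-toℕ X k) ⟩
      1ℤ + + 2 * (∑ n x - xk) - + 2 * + t
        ≡⟨ split-sum (∑ n x) xk (+ t) ⟩
      1ℤ - + 2 * xk - + 2 * + t + + 2 * ∑ n x
        ≈⟨ +-congˡ-[mod] (1ℤ - + 2 * xk - + 2 * + t) (*-cong-[mod] (+ 2)
             (∑-symmetric-[mod4] (row-periodic X) (row-±1 X-pm) (row-symmetric X-circ X-sym))) ⟩
      1ℤ - + 2 * xk - + 2 * + t + + 2 * (x 0 + + 2 * + t)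
        ≡⟨ regroup (x 0) xk (+ t) ⟩
      1ℤ + + 2 * (x 0 - xk) + + 2 * + t
        ∎
      where
      open SetoidReasoning ([mod]-setoid (+ 8))
      K = (2 ℕ.* toℕ k) mod n
      x = row X
      xk = X fzero k
      split-sum : ∀ s v t → 1ℤ + + 2 * (s - v) - + 2 * t ≡ 1ℤ - + 2 * v - + 2 * t + + 2 * s
      split-sum = solve-∀
      regroup : ∀ x0 v t → 1ℤ - + 2 * v - + 2 * t + + 2 * (x0 + + 2 * t) ≡ 1ℤ + + 2 * (x0 - v) + + 2 * t
      regroup = solve-∀

    good-entry-[mod8] : ∀ {A B C D} → Good (2 ℕ.* t) A B C D → ∀ k → 1 ℕ.≤ toℕ k →
      + 2 * (A fzero ((2 ℕ.* toℕ k) mod n) + A fzero k + B fzero fzero + C fzero fzero + D fzero fzero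
             - B fzero k - C fzero k - D fzero k) ≡ + 2 * 0ℤ [mod + 2 * + 4 ]
    good-entry-[mod8] {A} {B} {C} {D} ((A-pm , B-pm , C-pm , D-pm) , (A-circ , B-circ , C-circ , D-circ) ,
                                       (A-skew , B-sym , C-sym , D-sym) , gram≡4nI) k 1≤k = begin
      + 2 * T
        ≈⟨ +-*-[mod] (+ 2 * T) (+ t) (+ 8) ⟨
      + 2 * T + + t * + 8
        ≡⟨ collect aK (A fzero k) b0 c0 d0 (B fzero k) (C fzero k) (D fzero k) (+ t) ⟩
      + 2 * (aK + A fzero k) - + 3 + + 2 * + t
        + (1ℤ + + 2 * (b0 - B fzero k) + + 2 * + t)
        + (1ℤ + + 2 * (c0 - C fzero k) + + 2 * + t)
        + (1ℤ + + 2 * (d0 - D fzero k) + + 2 * + t)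
        ≈⟨ +-cong-[mod] (+-cong-[mod] (+-cong-[mod] (skew-gram-[mod8] A-pm A-circ A-skew k)
                                                    (symmetric-square-[mod8] B-pm B-circ B-sym k))
                                      (symmetric-square-[mod8] C-pm C-circ C-sym k))
                        (symmetric-square-[mod8] D-pm D-circ D-sym k) ⟨
      ((((A · transpose A) ⊕ (B · B)) ⊕ (C · C)) ⊕ (D · D)) fzero K
        ≡⟨ cong (λ M → M fzero K) gram≡4nI ⟩
      scalarId (+ (4 ℕ.* n)) fzero K
        ≡⟨ scalarId-off-diagonal _ fzero K (K≢0 ∘ sym) ⟩
      0ℤ
        ∎
      where
      open SetoidReasoning ([mod]-setoid (+ 8))
      K = (2 ℕ.* toℕ k) mod n
      aK = A fzero K
      b0 = B fzero fzero
      c0 = C fzero fzero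
      d0 = D fzero fzero
      T = aK + A fzero k + b0 + c0 + d0 - B fzero k - C fzero k - D fzero k
      K≢0 : toℕ K ≢ 0
      K≢0 = double-%-≢0 1≤k (Finₚ.toℕ<n k) ∘ trans (sym (toℕ-mod (2 ℕ.* toℕ k)))
      collect : ∀ aK ak b0 c0 d0 bk ck dk t →
        + 2 * (aK + ak + b0 + c0 + d0 - bk - ck - dk) + t * + 8
          ≡ + 2 * (aK + ak) - + 3 + + 2 * t + (1ℤ + + 2 * (b0 - bk) + + 2 * t)
            + (1ℤ + + 2 * (c0 - ck) + + 2 * t) + (1ℤ + + 2 * (d0 - dk) + + 2 * t)
      collect = solve-∀

open import Defs
open import Data.Nat using (ℕ; suc; _*_; _≤_; _<_)
open import Data.Nat.DivMod using (_mod_)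
open import Data.Fin using (Fin; toℕ; zero)
open import Data.Integer using (-_) renaming (_*_ to _*ℤ_)
open import Relation.Binary.PropositionalEquality using (_≡_; refl)
open import Data.Integer using (+_)
open import Data.List.Relation.Unary.All using (_∷_; [])
open import Data.Product using (_,_)
open GoodMatrices using (sign-rule; *-cancel-[mod]; module Odd)

theorem8 : (m : ℕ) → (A B C D : Matrix (suc m)) →
    -- n = suc m is odd: n = 2 * t + 1
    (t : ℕ) → suc m ≡ suc (2 * t) →
    Good m A B C D →
    (k : Fin (suc m)) → 1 ≤ toℕ k →
    A zero k *ℤ B zero k *ℤ C zero k *ℤ D zero k
      ≡ - (A zero ((2 * toℕ k) mod (suc m)) *ℤ B zero zero *ℤ C zero zero *ℤ D zero zero)
theorem8 .(2 * t) A B C D t refl good@((A-pm , B-pm , C-pm , D-pm) , _) k 1≤k =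
  sign-rule (A-pm zero K ∷ A-pm zero k ∷ B-pm zero zero ∷ C-pm zero zero ∷ D-pm zero zero
             ∷ B-pm zero k ∷ C-pm zero k ∷ D-pm zero k ∷ [])
            (*-cancel-[mod] (+ 2) (Odd.good-entry-[mod8] t good k 1≤k))
  where
  K = (2 * toℕ k) mod suc (2 * t)
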